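{- For all natural numbers $k\leq s$ and all natural numbers $n\geq k^2\binom{s}{k}+k$ we have $D(k,s,n)=k$.
   Context: For a natural number $n$, $[n]=\{1,\dots,n\}$, and for a set $A$ and $s\in\mathbb{N}$, $\binom{A}{s}$ denotes the set of $s$-element subsets of $A$. A set $A$ is shattered by a family $\mathcal{F}$ of sets if $\{A\cap S: S\in\mathcal{F}\}=2^A$. The VC-dimension of $\mathcal{F}$ is the size of the largest finite set shattered by $\mathcal{F}$ (or $\infty$ if there is no maximum). A family $\mathcal{F}\subseteq 2^X$ has the $k$-covering property if every $k$-element subset of $X$ is contained in some member of $\mathcal{F}$. For natural numbers $k\leq s\leq n$, $D(k,s,n)$ denotes the smallest VC-dimension of a family $\mathcal{F}\subseteq\binom{[n]}{s}$ having the $k$-covering property (as subsets of $X=[n]$). -}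

module Defs where

open import Data.Nat using (ℕ; _≤_)
open import Data.Product using (Σ; ∃; _×_)
open import Data.List using (List)
open import Data.List.Membership.Propositional using () renaming (_∈_ to _∈ᴸ_)
open import Data.Fin.Subset using (Subset; _⊆_; _∩_; ∣_∣)
open import Relation.Binary.PropositionalEquality using (_≡_)

Family : ℕ → Set
Family n = List (Subset n)

Shattered : {n : ℕ} → Family n → Subset n → Set
Shattered F A = ∀ B → B ⊆ A → Σ _ λ S → S ∈ᴸ F × (A ∩ S ≡ B)

HasVCdim : {n : ℕ} → Family n → ℕ → Set
HasVCdim F d = (Σ _ λ A → Shattered F A × ∣ A ∣ ≡ d)
             × (∀ A → Shattered F A → ∣ A ∣ ≤ d)

Uniform : {n : ℕ} → ℕ → Family n → Set
Uniform s F = ∀ S → S ∈ᴸ F → ∣ S ∣ ≡ s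

Covering : {n : ℕ} → ℕ → Family n → Set
Covering k F = ∀ K → ∣ K ∣ ≡ k → Σ _ λ S → S ∈ᴸ F × K ⊆ S

Admissible : (k s n : ℕ) → Family n → Set
Admissible k s n F = Uniform s F × Covering k F

IsD : (k s n d : ℕ) → Set
IsD k s n d = (Σ (Family n) λ F → Admissible k s n F × HasVCdim F d)
            × (∀ (F : Family n) → Admissible k s n F → ∀ e → HasVCdim F e → d ≤ e)

-- Upper bound: the s-subsets of [n] containing a fixed (s−k)-set Q form a k-covering family; a set A
-- it shatters is disjoint from Q (some member S has A ∩ S = ∅) and lies with Q inside one member,
-- so ∣Q∣ + ∣A∣ ≤ s, i.e. ∣A∣ ≤ k.
-- Lower bound: double counting the pairs (K, S) with K a k-set inside a member S shows that a
-- k-covering family of s-sets has at least C(n,k)/C(s,k) members. By Pajor's lemma it shatters at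
-- least as many sets, but only Σ_{j<k} C(n,j) ≤ k·C(n,k−1) sets have fewer than k elements, and
-- k·C(n,k−1)·C(s,k) < C(n,k) = C(n,k−1)(n−k+1)/k is exactly k²C(s,k) + k ≤ n.
module Submission where

open import Defs
open import Algebra.Properties.CommutativeSemigroup using (interchange)
open import Data.Bool using (Bool; true; false; T; _∧_; not)
open import Data.Bool.Properties using (∧-zeroʳ; T-∧; T-≡) renaming (_≟_ to _≟ᵇ_)
open import Data.Empty using (⊥-elim)
open import Data.Fin using (zero)
open import Data.Fin.Subset using (Subset; outside; inside; _⊆_; _∩_; _∪_; _∈_; ⊥; ⊤; ∣_∣; Empty)
open import Data.Fin.Subset.Properties
  using (anySubset?; _⊆?_; ⊆⊤; ⊥⊆; ∉⊥; ∣⊤∣≡n; ∣⊥∣≡0; ∣p∣≤∣x∷p∣; drop-∷-⊆; drop-∷-Empty; s⊆s; ⊆-refl; ⊆-trans;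
         p⊆p∪q; q⊆p∪q; p∩q⊆q; x∈p∩q⁺; x∈p∩q⁻)
open import Data.List using (List; []; _∷_; map; filter; null; _++_)
open import Data.List.Membership.Propositional using () renaming (_∈_ to _∈ᴸ_)
open import Data.List.Membership.Propositional.Properties
  using (∈-map⁺; ∈-map⁻; ∈-map∘filter⁺; ∈-map∘filter⁻; ∈-++⁺ˡ; ∈-++⁺ʳ; ∈-filter⁺; ∈-filter⁻)
open import Data.List.Relation.Binary.Subset.Propositional using () renaming (_⊆_ to _⊆ᴸ_)
import Data.List.Relation.Binary.Subset.Propositional.Properties as ⊆ᴸ
open import Data.List.Relation.Unary.Any using (here; there)
open import Data.Nat
open import Data.Nat.Combinatorics using (_C_; nC1≡n; nCk+nC[k+1]≡[n+1]C[k+1])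
open import Data.Nat.Properties
open import Data.Nat.Tactic.RingSolver using (solve-∀)
open import Data.Product using (∃; _×_; _,_; proj₁; proj₂)
open import Data.Vec using ([]; _∷_; head; tail; here)
open import Function using (_∘_; case_of_; Equivalence)
open import Relation.Nullary using (¬_; yes; no; does; contradiction)
open import Relation.Nullary.Decidable using (_×-dec_; dec-true)
open import Relation.Binary.PropositionalEquality hiding ([_])

private variable n : ℕ

nC[1+k]*[1+k]+nCk*k≡nCk*n : ∀ n k → (n C suc k) * suc k + (n C k) * k ≡ (n C k) * n
nC[1+k]*[1+k]+nCk*k≡nCk*n zero    zero    = refl
nC[1+k]*[1+k]+nCk*k≡nCk*n zero    (suc k) = refl
nC[1+k]*[1+k]+nCk*k≡nCk*n (suc n) zero    = begin
  (suc n C 1) * 1 + 0  ≡⟨ +-identityʳ _ ⟩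
  (suc n C 1) * 1      ≡⟨ *-identityʳ _ ⟩
  suc n C 1            ≡⟨ nC1≡n (suc n) ⟩
  suc n                ≡⟨ *-identityˡ (suc n) ⟨
  1 * suc n            ∎
  where open ≡-Reasoning
nC[1+k]*[1+k]+nCk*k≡nCk*n (suc n) (suc k) = begin
  (suc n C suc (suc k)) * suc (suc k) + (suc n C suc k) * suc k
    ≡⟨ cong₂ (λ x y → x * suc (suc k) + y * suc k) (nCk+nC[k+1]≡[n+1]C[k+1] n (suc k)) (nCk+nC[k+1]≡[n+1]C[k+1] n k) ⟨
  (b₁ + b₂) * suc (suc k) + (b₀ + b₁) * suc k
    ≡⟨ regroup b₀ b₁ b₂ k ⟩
  (b₂ * suc (suc k) + b₁ * suc k) + (b₁ * suc k + b₀ * k) + b₁ + b₀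
    ≡⟨ cong₂ (λ x y → x + y + b₁ + b₀) (nC[1+k]*[1+k]+nCk*k≡nCk*n n (suc k)) (nC[1+k]*[1+k]+nCk*k≡nCk*n n k) ⟩
  b₁ * n + b₀ * n + b₁ + b₀
    ≡⟨ collect b₀ b₁ n ⟩
  (b₀ + b₁) * suc n
    ≡⟨ cong (_* suc n) (nCk+nC[k+1]≡[n+1]C[k+1] n k) ⟩
  (suc n C suc k) * suc n ∎
  where
  open ≡-Reasoning
  b₀ b₁ b₂ : ℕ
  b₀ = n C k
  b₁ = n C suc k
  b₂ = n C suc (suc k)
  regroup : ∀ b₀ b₁ b₂ k → (b₁ + b₂) * suc (suc k) + (b₀ + b₁) * suc k
                         ≡ (b₂ * suc (suc k) + b₁ * suc k) + (b₁ * suc k + b₀ * k) + b₁ + b₀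
  regroup = solve-∀
  collect : ∀ b₀ b₁ n → b₁ * n + b₀ * n + b₁ + b₀ ≡ (b₀ + b₁) * suc n
  collect = solve-∀

0<nCk : ∀ {n k} → k ≤ n → 0 < n C k
0<nCk {k = zero}          _         = z<s
0<nCk {suc n} {suc k} (s≤s k≤n) = begin-strict
  0                    <⟨ 0<nCk k≤n ⟩
  n C k                ≤⟨ m≤m+n (n C k) _ ⟩
  n C k + n C suc k    ≡⟨ nCk+nC[k+1]≡[n+1]C[k+1] n k ⟩
  suc n C suc k        ∎
  where open ≤-Reasoning

nCk≤nC[1+k] : ∀ {n k} → k + k < n → n C k ≤ n C suc k
nCk≤nC[1+k] {n} {k} 2k<n = *-cancelʳ-≤ (n C k) (n C suc k) (suc k) (+-cancelʳ-≤ ((n C k) * k) _ _ (begin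
  (n C k) * suc k + (n C k) * k      ≡⟨ *-distribˡ-+ (n C k) (suc k) k ⟨
  (n C k) * (suc k + k)              ≤⟨ *-monoʳ-≤ (n C k) 2k<n ⟩
  (n C k) * n                        ≡⟨ nC[1+k]*[1+k]+nCk*k≡nCk*n n k ⟨
  (n C suc k) * suc k + (n C k) * k  ∎))
  where open ≤-Reasoning

[_] : Bool → ℕ
[ true  ] = 1
[ false ] = 0

[b]≤x : ∀ {b x} → (T b → 1 ≤ x) → [ b ] ≤ x
[b]≤x {false} _   = z≤n
[b]≤x {true}  1≤x = 1≤x _

1≤[a]*[b] : ∀ {a b} → T a → T b → 1 ≤ [ a ] * [ b ]
1≤[a]*[b] {true} {true} _ _ = ≤-refl

[b]*x≡[b]*y : ∀ {b x y} → (T b → x ≡ y) → [ b ] * x ≡ [ b ] * y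
[b]*x≡[b]*y {false} _   = refl
[b]*x≡[b]*y {true}  x≡y = cong (1 *_) (x≡y _)

[a]<[b]⇒¬a×b : ∀ {a b} → [ a ] < [ b ] → ¬ T a × T b
[a]<[b]⇒¬a×b {false} {true} _ = (λ ()) , _
[a]<[b]⇒¬a×b {true}  {true} (s≤s ())

∑ : ∀ n → (Subset n → ℕ) → ℕ
∑ zero    f = f []
∑ (suc n) f = ∑ n (f ∘ (outside ∷_)) + ∑ n (f ∘ (inside ∷_))

∑-cong : ∀ n {f g : Subset n → ℕ} → (∀ x → f x ≡ g x) → ∑ n f ≡ ∑ n g
∑-cong zero    f≗g = f≗g []
∑-cong (suc n) f≗g = cong₂ _+_ (∑-cong n (f≗g ∘ (outside ∷_))) (∑-cong n (f≗g ∘ (inside ∷_)))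

∑-mono-≤ : ∀ n {f g : Subset n → ℕ} → (∀ x → f x ≤ g x) → ∑ n f ≤ ∑ n g
∑-mono-≤ zero    f≤g = f≤g []
∑-mono-≤ (suc n) f≤g = +-mono-≤ (∑-mono-≤ n (f≤g ∘ (outside ∷_))) (∑-mono-≤ n (f≤g ∘ (inside ∷_)))

∑-0 : ∀ n → ∑ n (λ _ → 0) ≡ 0
∑-0 zero    = refl
∑-0 (suc n) = cong₂ _+_ (∑-0 n) (∑-0 n)

∑-distrib-+ : ∀ n (f g : Subset n → ℕ) → ∑ n (λ x → f x + g x) ≡ ∑ n f + ∑ n g
∑-distrib-+ zero    f g = refl
∑-distrib-+ (suc n) f g = trans (cong₂ _+_ (∑-distrib-+ n (f ∘ (outside ∷_)) (g ∘ (outside ∷_)))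
                                           (∑-distrib-+ n (f ∘ (inside ∷_)) (g ∘ (inside ∷_))))
                               (interchange +-commutativeSemigroup (∑ n (f ∘ (outside ∷_))) (∑ n (g ∘ (outside ∷_))) _ _)

∑-distribˡ-* : ∀ n (c : ℕ) (f : Subset n → ℕ) → ∑ n (λ x → c * f x) ≡ c * ∑ n f
∑-distribˡ-* zero    c f = refl
∑-distribˡ-* (suc n) c f = trans (cong₂ _+_ (∑-distribˡ-* n c (f ∘ (outside ∷_))) (∑-distribˡ-* n c (f ∘ (inside ∷_))))
                                 (sym (*-distribˡ-+ c (∑ n (f ∘ (outside ∷_))) _))

∑-distribʳ-* : ∀ n (f : Subset n → ℕ) (c : ℕ) → ∑ n (λ x → f x * c) ≡ ∑ n f * c
∑-distribʳ-* zero    f c = refl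
∑-distribʳ-* (suc n) f c = trans (cong₂ _+_ (∑-distribʳ-* n (f ∘ (outside ∷_)) c) (∑-distribʳ-* n (f ∘ (inside ∷_)) c))
                                 (sym (*-distribʳ-+ c (∑ n (f ∘ (outside ∷_))) _))

∑-swap : ∀ n m (h : Subset n → Subset m → ℕ) → ∑ n (λ x → ∑ m (h x)) ≡ ∑ m (λ y → ∑ n (λ x → h x y))
∑-swap zero    m h = refl
∑-swap (suc n) m h = trans (cong₂ _+_ (∑-swap n m (h ∘ (outside ∷_))) (∑-swap n m (h ∘ (inside ∷_))))
                           (sym (∑-distrib-+ m (λ y → ∑ n (λ x → h (outside ∷ x) y)) (λ y → ∑ n (λ x → h (inside ∷ x) y))))

f≤∑f : ∀ {n} (f : Subset n → ℕ) (x : Subset n) → f x ≤ ∑ n f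
f≤∑f f []            = ≤-refl
f≤∑f f (outside ∷ x) = ≤-trans (f≤∑f (f ∘ (outside ∷_)) x) (m≤m+n _ _)
f≤∑f f (inside ∷ x)  = ≤-trans (f≤∑f (f ∘ (inside ∷_)) x) (m≤n+m _ _)

∑<∑⇒∃< : ∀ n (f g : Subset n → ℕ) → ∑ n f < ∑ n g → ∃ λ x → f x < g x
∑<∑⇒∃< n f g ∑f<∑g with anySubset? (λ x → f x <? g x)
... | yes fx<gx  = fx<gx
... | no  ∄fx<gx = contradiction ∑f<∑g (≤⇒≯ (∑-mono-≤ n λ x → ≮⇒≥ λ fx<gx → ∄fx<gx (x , fx<gx)))

∑[⊆S∧size≡k]≡∣S∣Ck : ∀ {n} (S : Subset n) k → ∑ n (λ K → [ does (K ⊆? S) ∧ (∣ K ∣ ≡ᵇ k) ]) ≡ ∣ S ∣ C k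
∑[⊆S∧size≡k]≡∣S∣Ck []            zero    = refl
∑[⊆S∧size≡k]≡∣S∣Ck []            (suc k) = refl
∑[⊆S∧size≡k]≡∣S∣Ck {suc n} (outside ∷ S) k = begin
  ∑ n (λ K → [ does (K ⊆? S) ∧ (∣ K ∣ ≡ᵇ k) ]) + ∑ n (λ _ → 0) ≡⟨ cong₂ _+_ (∑[⊆S∧size≡k]≡∣S∣Ck S k) (∑-0 n) ⟩
  ∣ S ∣ C k + 0                                                ≡⟨ +-identityʳ _ ⟩
  ∣ S ∣ C k                                                    ∎
  where open ≡-Reasoning
∑[⊆S∧size≡k]≡∣S∣Ck {suc n} (inside ∷ S) zero = begin
  ∑ n (λ K → [ does (K ⊆? S) ∧ (∣ K ∣ ≡ᵇ 0) ]) + ∑ n (λ K → [ does (K ⊆? S) ∧ false ])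
    ≡⟨ cong₂ _+_ (∑[⊆S∧size≡k]≡∣S∣Ck S zero) (∑-cong n λ K → cong [_] (∧-zeroʳ (does (K ⊆? S)))) ⟩
  1 + ∑ n (λ _ → 0)
    ≡⟨ cong (1 +_) (∑-0 n) ⟩
  1 ∎
  where open ≡-Reasoning
∑[⊆S∧size≡k]≡∣S∣Ck {suc n} (inside ∷ S) (suc k) = begin
  ∑ n (λ K → [ does (K ⊆? S) ∧ (∣ K ∣ ≡ᵇ suc k) ]) + ∑ n (λ K → [ does (K ⊆? S) ∧ (∣ K ∣ ≡ᵇ k) ])
    ≡⟨ cong₂ _+_ (∑[⊆S∧size≡k]≡∣S∣Ck S (suc k)) (∑[⊆S∧size≡k]≡∣S∣Ck S k) ⟩
  ∣ S ∣ C suc k + ∣ S ∣ C k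
    ≡⟨ +-comm (∣ S ∣ C suc k) (∣ S ∣ C k) ⟩
  ∣ S ∣ C k + ∣ S ∣ C suc k
    ≡⟨ nCk+nC[k+1]≡[n+1]C[k+1] ∣ S ∣ k ⟩
  suc ∣ S ∣ C suc k ∎
  where open ≡-Reasoning

∑[size≡k]≡nCk : ∀ n k → ∑ n (λ K → [ ∣ K ∣ ≡ᵇ k ]) ≡ n C k
∑[size≡k]≡nCk n k = begin
  ∑ n (λ K → [ ∣ K ∣ ≡ᵇ k ])                   ≡⟨ ∑-cong n (λ K → cong (λ b → [ b ∧ (∣ K ∣ ≡ᵇ k) ]) (dec-true (K ⊆? ⊤) ⊆⊤)) ⟨
  ∑ n (λ K → [ does (K ⊆? ⊤) ∧ (∣ K ∣ ≡ᵇ k) ]) ≡⟨ ∑[⊆S∧size≡k]≡∣S∣Ck (⊤ {n}) k ⟩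
  ∣ ⊤ {n} ∣ C k                                ≡⟨ cong (_C k) (∣⊤∣≡n n) ⟩
  n C k                                        ∎
  where open ≡-Reasoning

[m<ᵇ1+n]≡[m<ᵇn]+[m≡ᵇn] : ∀ m n → [ m <ᵇ suc n ] ≡ [ m <ᵇ n ] + [ m ≡ᵇ n ]
[m<ᵇ1+n]≡[m<ᵇn]+[m≡ᵇn] zero    zero    = refl
[m<ᵇ1+n]≡[m<ᵇn]+[m≡ᵇn] zero    (suc n) = refl
[m<ᵇ1+n]≡[m<ᵇn]+[m≡ᵇn] (suc m) zero    = refl
[m<ᵇ1+n]≡[m<ᵇn]+[m≡ᵇn] (suc m) (suc n) = [m<ᵇ1+n]≡[m<ᵇn]+[m≡ᵇn] m n

∑[size<1+j]≡∑[size<j]+nCj : ∀ n j → ∑ n (λ A → [ ∣ A ∣ <ᵇ suc j ]) ≡ ∑ n (λ A → [ ∣ A ∣ <ᵇ j ]) + n C j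
∑[size<1+j]≡∑[size<j]+nCj n j = begin
  ∑ n (λ A → [ ∣ A ∣ <ᵇ suc j ])                         ≡⟨ ∑-cong n (λ A → [m<ᵇ1+n]≡[m<ᵇn]+[m≡ᵇn] ∣ A ∣ j) ⟩
  ∑ n (λ A → [ ∣ A ∣ <ᵇ j ] + [ ∣ A ∣ ≡ᵇ j ])            ≡⟨ ∑-distrib-+ n (λ A → [ ∣ A ∣ <ᵇ j ]) (λ A → [ ∣ A ∣ ≡ᵇ j ]) ⟩
  ∑ n (λ A → [ ∣ A ∣ <ᵇ j ]) + ∑ n (λ A → [ ∣ A ∣ ≡ᵇ j ]) ≡⟨ cong (∑ n (λ A → [ ∣ A ∣ <ᵇ j ]) +_) (∑[size≡k]≡nCk n j) ⟩
  ∑ n (λ A → [ ∣ A ∣ <ᵇ j ]) + n C j                      ∎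
  where open ≡-Reasoning

∑[size<1+m]≤[1+m]*nCm : ∀ n m → m + m ≤ n → ∑ n (λ A → [ ∣ A ∣ <ᵇ suc m ]) ≤ suc m * (n C m)
∑[size<1+m]≤[1+m]*nCm n zero _ = ≤-reflexive (begin
  ∑ n (λ A → [ ∣ A ∣ <ᵇ 1 ]) ≡⟨ ∑[size<1+j]≡∑[size<j]+nCj n 0 ⟩
  ∑ n (λ _ → 0) + 1          ≡⟨ cong (_+ 1) (∑-0 n) ⟩
  1                          ∎)
  where open ≡-Reasoning
∑[size<1+m]≤[1+m]*nCm n (suc m) 2m+2≤n = begin
  ∑ n (λ A → [ ∣ A ∣ <ᵇ suc (suc m) ])        ≡⟨ ∑[size<1+j]≡∑[size<j]+nCj n (suc m) ⟩
  ∑ n (λ A → [ ∣ A ∣ <ᵇ suc m ]) + n C suc m  ≤⟨ +-monoˡ-≤ (n C suc m) (∑[size<1+m]≤[1+m]*nCm n m (<⇒≤ 2m<n)) ⟩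
  suc m * (n C m) + n C suc m                 ≤⟨ +-monoˡ-≤ (n C suc m) (*-monoʳ-≤ (suc m) (nCk≤nC[1+k] 2m<n)) ⟩
  suc m * (n C suc m) + n C suc m             ≡⟨ +-comm (suc m * (n C suc m)) _ ⟩
  suc (suc m) * (n C suc m)                   ∎
  where
  open ≤-Reasoning
  2m<n : m + m < n
  2m<n = ≤-trans (s≤s (+-monoʳ-≤ m (n≤1+n m))) 2m+2≤n

[1+m]*nCm*c<nC[1+m] : ∀ {n m} c → suc m * suc m * c + suc m ≤ n → suc m * (n C m) * c < n C suc m
[1+m]*nCm*c<nC[1+m] {n} {m} c gap = *-cancelʳ-< _ _ _ (+-cancelʳ-< (b * m) _ _ (begin-strict
  suc m * b * c * suc m + b * m   ≡⟨ regroup m b c ⟩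
  b * (suc m * suc m * c + m)     <⟨ *-monoʳ-< b (≤-trans (≤-reflexive (sym (+-suc _ m))) gap) ⟩
  b * n                           ≡⟨ nC[1+k]*[1+k]+nCk*k≡nCk*n n m ⟨
  (n C suc m) * suc m + b * m     ∎))
  where
  open ≤-Reasoning
  b : ℕ
  b = n C m
  instance
    _ : NonZero b
    _ = >-nonZero (0<nCk (≤-trans (n≤1+n m) (≤-trans (m≤n+m (suc m) _) gap)))
  regroup : ∀ m b c → suc m * b * c * suc m + b * m ≡ b * (suc m * suc m * c + m)
  regroup = solve-∀

∑[size<k]*c<nCk : ∀ n k c .{{_ : NonZero c}} → k * k * c + k ≤ n → ∑ n (λ A → [ ∣ A ∣ <ᵇ k ]) * c < n C k
∑[size<k]*c<nCk n zero    c _   = subst (λ x → x * c < 1) (sym (∑-0 n)) z<s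
∑[size<k]*c<nCk n (suc m) c gap = begin-strict
  ∑ n (λ A → [ ∣ A ∣ <ᵇ suc m ]) * c ≤⟨ *-monoˡ-≤ c (∑[size<1+m]≤[1+m]*nCm n m 2m≤n) ⟩
  suc m * (n C m) * c                 <⟨ [1+m]*nCm*c<nC[1+m] c gap ⟩
  n C suc m                           ∎
  where
  open ≤-Reasoning
  k : ℕ
  k = suc m
  m≤k*k*c : m ≤ k * k * c
  m≤k*k*c = ≤-trans (n≤1+n m) (≤-trans (m≤m*n k k) (m≤m*n (k * k) c))
  2m≤n : m + m ≤ n
  2m≤n = ≤-trans (+-mono-≤ m≤k*k*c (n≤1+n m)) gap

section : Bool → Family (suc n) → Family n
section b F = map tail (filter (λ S → head S ≟ᵇ b) F)

∈-section⁺ : ∀ {b} {S : Subset n} {F} → (b ∷ S) ∈ᴸ F → S ∈ᴸ section b F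
∈-section⁺ {b = b} {S} bS∈F = ∈-map∘filter⁺ tail (λ S → head S ≟ᵇ b) (b ∷ S , bS∈F , refl , refl)

∈-section⁻ : ∀ {b} {S : Subset n} {F} → S ∈ᴸ section b F → (b ∷ S) ∈ᴸ F
∈-section⁻ {b = b} S∈ with ∈-map∘filter⁻ tail (λ S → head S ≟ᵇ b) S∈
... | (.b ∷ _) , bS∈F , refl , refl = bS∈F

section-mono : ∀ {b} {F G : Family (suc n)} → F ⊆ᴸ G → section b F ⊆ᴸ section b G
section-mono F⊆G = ∈-section⁺ ∘ F⊆G ∘ ∈-section⁻

section⊆map-tail : ∀ {b} {F : Family (suc n)} → section b F ⊆ᴸ map tail F
section⊆map-tail = ∈-map⁺ tail ∘ ∈-section⁻

_∈ᵇ_ : Subset n → Family n → Bool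
[]      ∈ᵇ F = not (null F)
(x ∷ S) ∈ᵇ F = S ∈ᵇ section x F

∈⇒∈ᵇ : ∀ {S : Subset n} {F} → S ∈ᴸ F → T (S ∈ᵇ F)
∈⇒∈ᵇ {S = []}    (here _)  = _
∈⇒∈ᵇ {S = []}    (there _) = _
∈⇒∈ᵇ {S = _ ∷ _} S∈F       = ∈⇒∈ᵇ (∈-section⁺ S∈F)

∈ᵇ⇒∈ : ∀ {S : Subset n} {F} → T (S ∈ᵇ F) → S ∈ᴸ F
∈ᵇ⇒∈ {S = []}    {[] ∷ _} _ = here refl
∈ᵇ⇒∈ {S = _ ∷ _}          t = ∈-section⁻ (∈ᵇ⇒∈ t)

-- A ∌ 0 is shattered by F iff it is shattered by the traces of F on the other points, and A ∋ 0 iff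
-- A − {0} is shattered by both sections of F at 0.
shatteredᵇ : Family n → Subset n → Bool
shatteredᵇ F []            = not (null F)
shatteredᵇ F (outside ∷ A) = shatteredᵇ (map tail F) A
shatteredᵇ F (inside ∷ A)  = shatteredᵇ (section outside F) A ∧ shatteredᵇ (section inside F) A

shatteredᵇ-mono : ∀ {F G : Family n} A → F ⊆ᴸ G → T (shatteredᵇ F A) → T (shatteredᵇ G A)
shatteredᵇ-mono {F = _ ∷ _} {[]}    []            F⊆G _ with F⊆G (here refl)
... | ()
shatteredᵇ-mono {F = _ ∷ _} {_ ∷ _} []            F⊆G _ = _
shatteredᵇ-mono                     (outside ∷ A) F⊆G t = shatteredᵇ-mono A (⊆ᴸ.map⁺ tail F⊆G) t
shatteredᵇ-mono                     (inside ∷ A)  F⊆G t with Equivalence.to T-∧ t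
... | t₀ , t₁ = Equivalence.from T-∧ (shatteredᵇ-mono A (section-mono F⊆G) t₀ , shatteredᵇ-mono A (section-mono F⊆G) t₁)

shatteredᵇ-section : ∀ {F : Family (suc n)} A b → T (shatteredᵇ F (inside ∷ A)) → T (shatteredᵇ (section b F) A)
shatteredᵇ-section A outside t = proj₁ (Equivalence.to T-∧ t)
shatteredᵇ-section A inside  t = proj₂ (Equivalence.to T-∧ t)

shatteredᵇ⇒Shattered : ∀ {F : Family n} A → T (shatteredᵇ F A) → Shattered F A
shatteredᵇ⇒Shattered {F = [] ∷ _} [] _ [] _ = [] , here refl , refl
shatteredᵇ⇒Shattered (outside ∷ A) t (inside ∷ B) B⊆A with B⊆A here
... | ()
shatteredᵇ⇒Shattered (outside ∷ A) t (outside ∷ B) B⊆A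
  with shatteredᵇ⇒Shattered A t B (drop-∷-⊆ B⊆A)
... | S , S∈ , A∩S≡B with ∈-map⁻ tail S∈
... | (x ∷ S) , xS∈F , refl = (x ∷ S) , xS∈F , cong (outside ∷_) A∩S≡B
shatteredᵇ⇒Shattered {F = F} (inside ∷ A) t (b ∷ B) B⊆A
  with shatteredᵇ⇒Shattered A (shatteredᵇ-section {F = F} A b t) B (drop-∷-⊆ B⊆A)
... | S , S∈ , A∩S≡B = (b ∷ S) , ∈-section⁻ {F = F} S∈ , cong (b ∷_) A∩S≡B

[a]+[b]≤[c]+[a∧b] : ∀ {a b c} → (T a → T c) → (T b → T c) → [ a ] + [ b ] ≤ [ c ] + [ a ∧ b ]
[a]+[b]≤[c]+[a∧b] {false} {false}         _   _   = z≤n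
[a]+[b]≤[c]+[a∧b] {true}  {_}     {true}  _   _   = ≤-refl
[a]+[b]≤[c]+[a∧b] {false} {true}  {true}  _   _   = ≤-refl
[a]+[b]≤[c]+[a∧b] {true}  {_}     {false} a⇒c _   = ⊥-elim (a⇒c _)
[a]+[b]≤[c]+[a∧b] {false} {true}  {false} _   b⇒c = ⊥-elim (b⇒c _)

#members≤#shattered : ∀ n (F : Family n) → ∑ n (λ S → [ S ∈ᵇ F ]) ≤ ∑ n (λ A → [ shatteredᵇ F A ])
#members≤#shattered zero    F = ≤-refl
#members≤#shattered (suc n) F = begin
  ∑ n (λ S → [ S ∈ᵇ F₀ ]) + ∑ n (λ S → [ S ∈ᵇ F₁ ])
    ≤⟨ +-mono-≤ (#members≤#shattered n F₀) (#members≤#shattered n F₁) ⟩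
  ∑ n (λ A → [ shatteredᵇ F₀ A ]) + ∑ n (λ A → [ shatteredᵇ F₁ A ])
    ≡⟨ ∑-distrib-+ n (λ A → [ shatteredᵇ F₀ A ]) (λ A → [ shatteredᵇ F₁ A ]) ⟨
  ∑ n (λ A → [ shatteredᵇ F₀ A ] + [ shatteredᵇ F₁ A ])
    ≤⟨ ∑-mono-≤ n (λ A → [a]+[b]≤[c]+[a∧b] (shatteredᵇ-mono A section⊆map-tail) (shatteredᵇ-mono A section⊆map-tail)) ⟩
  ∑ n (λ A → [ shatteredᵇ (map tail F) A ] + [ shatteredᵇ F₀ A ∧ shatteredᵇ F₁ A ])
    ≡⟨ ∑-distrib-+ n (λ A → [ shatteredᵇ (map tail F) A ]) (λ A → [ shatteredᵇ F₀ A ∧ shatteredᵇ F₁ A ]) ⟩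
  ∑ n (λ A → [ shatteredᵇ (map tail F) A ]) + ∑ n (λ A → [ shatteredᵇ F₀ A ∧ shatteredᵇ F₁ A ]) ∎
  where
  open ≤-Reasoning
  F₀ F₁ : Family n
  F₀ = section outside F
  F₁ = section inside F

covering⇒nCk≤#members*sCk : ∀ {k s n} {F : Family n} → Uniform s F → Covering k F →
                             n C k ≤ ∑ n (λ S → [ S ∈ᵇ F ]) * (s C k)
covering⇒nCk≤#members*sCk {k} {s} {n} {F} uniform covering = begin
  n C k
    ≡⟨ ∑[size≡k]≡nCk n k ⟨
  ∑ n (λ K → [ ∣ K ∣ ≡ᵇ k ])
    ≤⟨ ∑-mono-≤ n covered ⟩
  ∑ n (λ K → ∑ n (λ S → [ S ∈ᵇ F ] * [ does (K ⊆? S) ∧ (∣ K ∣ ≡ᵇ k) ]))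
    ≡⟨ ∑-swap n n (λ K S → [ S ∈ᵇ F ] * [ does (K ⊆? S) ∧ (∣ K ∣ ≡ᵇ k) ]) ⟩
  ∑ n (λ S → ∑ n (λ K → [ S ∈ᵇ F ] * [ does (K ⊆? S) ∧ (∣ K ∣ ≡ᵇ k) ]))
    ≡⟨ ∑-cong n (λ S → ∑-distribˡ-* n [ S ∈ᵇ F ] (λ K → [ does (K ⊆? S) ∧ (∣ K ∣ ≡ᵇ k) ])) ⟩
  ∑ n (λ S → [ S ∈ᵇ F ] * ∑ n (λ K → [ does (K ⊆? S) ∧ (∣ K ∣ ≡ᵇ k) ]))
    ≡⟨ ∑-cong n (λ S → [b]*x≡[b]*y λ S∈F → trans (∑[⊆S∧size≡k]≡∣S∣Ck S k) (cong (_C k) (uniform S (∈ᵇ⇒∈ S∈F)))) ⟩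
  ∑ n (λ S → [ S ∈ᵇ F ] * (s C k))
    ≡⟨ ∑-distribʳ-* n (λ S → [ S ∈ᵇ F ]) (s C k) ⟩
  ∑ n (λ S → [ S ∈ᵇ F ]) * (s C k) ∎
  where
  open ≤-Reasoning
  covered : ∀ K → [ ∣ K ∣ ≡ᵇ k ] ≤ ∑ n (λ S → [ S ∈ᵇ F ] * [ does (K ⊆? S) ∧ (∣ K ∣ ≡ᵇ k) ])
  covered K = [b]≤x λ ∣K∣≡ᵇk → case covering K (≡ᵇ⇒≡ ∣ K ∣ k ∣K∣≡ᵇk) of λ where
    (S , S∈F , K⊆S) → ≤-trans (1≤[a]*[b] (∈⇒∈ᵇ S∈F) (Equivalence.from T-∧ (Equivalence.from T-≡ (dec-true (K ⊆? S) K⊆S) , ∣K∣≡ᵇk)))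
                              (f≤∑f (λ S → [ S ∈ᵇ F ] * [ does (K ⊆? S) ∧ (∣ K ∣ ≡ᵇ k) ]) S)

shatters-large-set : ∀ {k s n} {F : Family n} → k ≤ s → k * k * (s C k) + k ≤ n → Admissible k s n F →
                     ∃ λ A → Shattered F A × k ≤ ∣ A ∣
shatters-large-set {k} {s} {n} {F} k≤s gap (uniform , covering) =
  A , shatteredᵇ⇒Shattered A A-shattered , ≮⇒≥ (∣A∣≮k ∘ <⇒<ᵇ)
  where
  instance
    _ : NonZero (s C k)
    _ = >-nonZero (0<nCk k≤s)
  #small<#shattered : ∑ n (λ A → [ ∣ A ∣ <ᵇ k ]) < ∑ n (λ A → [ shatteredᵇ F A ])
  #small<#shattered = begin-strict
    ∑ n (λ A → [ ∣ A ∣ <ᵇ k ])          <⟨ *-cancelʳ-< _ _ _ (begin-strict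
      ∑ n (λ A → [ ∣ A ∣ <ᵇ k ]) * (s C k)   <⟨ ∑[size<k]*c<nCk n k (s C k) gap ⟩
      n C k                                  ≤⟨ covering⇒nCk≤#members*sCk uniform covering ⟩
      ∑ n (λ S → [ S ∈ᵇ F ]) * (s C k)       ∎) ⟩
    ∑ n (λ S → [ S ∈ᵇ F ])              ≤⟨ #members≤#shattered n F ⟩
    ∑ n (λ A → [ shatteredᵇ F A ])      ∎
    where open ≤-Reasoning
  witness : ∃ λ A → [ ∣ A ∣ <ᵇ k ] < [ shatteredᵇ F A ]
  witness = ∑<∑⇒∃< n (λ A → [ ∣ A ∣ <ᵇ k ]) (λ A → [ shatteredᵇ F A ]) #small<#shattered
  A : Subset n
  A = proj₁ witness
  ∣A∣≮k : ¬ T (∣ A ∣ <ᵇ k)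
  ∣A∣≮k = proj₁ ([a]<[b]⇒¬a×b (proj₂ witness))
  A-shattered : T (shatteredᵇ F A)
  A-shattered = proj₂ ([a]<[b]⇒¬a×b (proj₂ witness))

∣p∪q∣≤∣p∣+∣q∣ : ∀ (p q : Subset n) → ∣ p ∪ q ∣ ≤ ∣ p ∣ + ∣ q ∣
∣p∪q∣≤∣p∣+∣q∣ []            []            = z≤n
∣p∪q∣≤∣p∣+∣q∣ (outside ∷ p) (outside ∷ q) = ∣p∪q∣≤∣p∣+∣q∣ p q
∣p∪q∣≤∣p∣+∣q∣ (outside ∷ p) (inside ∷ q)  = ≤-trans (s≤s (∣p∪q∣≤∣p∣+∣q∣ p q)) (≤-reflexive (sym (+-suc ∣ p ∣ ∣ q ∣)))
∣p∪q∣≤∣p∣+∣q∣ (inside ∷ p)  (y ∷ q)       = s≤s (≤-trans (∣p∪q∣≤∣p∣+∣q∣ p q) (+-monoʳ-≤ ∣ p ∣ (∣p∣≤∣x∷p∣ y q)))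

disjoint-⊆⇒∣p∣+∣q∣≤∣r∣ : ∀ {p q r : Subset n} → Empty (p ∩ q) → p ⊆ r → q ⊆ r → ∣ p ∣ + ∣ q ∣ ≤ ∣ r ∣
disjoint-⊆⇒∣p∣+∣q∣≤∣r∣ {p = []}          {[]}          {[]}          _     _   _   = z≤n
disjoint-⊆⇒∣p∣+∣q∣≤∣r∣ {p = inside ∷ _}  {inside ∷ _}  {_}           p∩q=∅ _   _   = ⊥-elim (p∩q=∅ (zero , here))
disjoint-⊆⇒∣p∣+∣q∣≤∣r∣ {p = inside ∷ _}  {outside ∷ _} {outside ∷ _} _     p⊆r _   = contradiction (p⊆r here) λ ()
disjoint-⊆⇒∣p∣+∣q∣≤∣r∣ {p = outside ∷ _} {inside ∷ _}  {outside ∷ _} _     _   q⊆r = contradiction (q⊆r here) λ ()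
disjoint-⊆⇒∣p∣+∣q∣≤∣r∣ {p = inside ∷ _}  {outside ∷ _} {inside ∷ _}  p∩q=∅ p⊆r q⊆r =
  s≤s (disjoint-⊆⇒∣p∣+∣q∣≤∣r∣ (drop-∷-Empty p∩q=∅) (drop-∷-⊆ p⊆r) (drop-∷-⊆ q⊆r))
disjoint-⊆⇒∣p∣+∣q∣≤∣r∣ {p = outside ∷ p} {inside ∷ q} {inside ∷ _}  p∩q=∅ p⊆r q⊆r =
  ≤-trans (≤-reflexive (+-suc ∣ p ∣ ∣ q ∣))
          (s≤s (disjoint-⊆⇒∣p∣+∣q∣≤∣r∣ (drop-∷-Empty p∩q=∅) (drop-∷-⊆ p⊆r) (drop-∷-⊆ q⊆r)))
disjoint-⊆⇒∣p∣+∣q∣≤∣r∣ {p = outside ∷ _} {outside ∷ _} {z ∷ r}      p∩q=∅ p⊆r q⊆r =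
  ≤-trans (disjoint-⊆⇒∣p∣+∣q∣≤∣r∣ (drop-∷-Empty p∩q=∅) (drop-∷-⊆ p⊆r) (drop-∷-⊆ q⊆r)) (∣p∣≤∣x∷p∣ z r)

superset-of-size : ∀ (p : Subset n) {m} → ∣ p ∣ ≤ m → m ≤ n → ∃ λ q → p ⊆ q × ∣ q ∣ ≡ m
superset-of-size []            z≤n z≤n = [] , ⊆-refl , refl
superset-of-size (inside ∷ p)  (s≤s ∣p∣≤m) (s≤s m≤n) with superset-of-size p ∣p∣≤m m≤n
... | q , p⊆q , ∣q∣≡m = inside ∷ q , s⊆s p⊆q , cong suc ∣q∣≡m
superset-of-size {suc n} (outside ∷ p) {m} ∣p∣≤m m≤1+n with m ≤? n
... | yes m≤n with superset-of-size p ∣p∣≤m m≤n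
...   | q , p⊆q , ∣q∣≡m = outside ∷ q , s⊆s p⊆q , ∣q∣≡m
superset-of-size {suc n} (outside ∷ p) {m} ∣p∣≤m m≤1+n | no m≰n =
  ⊤ , ⊆⊤ , trans (∣⊤∣≡n (suc n)) (≤-antisym (≰⇒> m≰n) m≤1+n)

allSubsets : ∀ n → List (Subset n)
allSubsets zero    = [] ∷ []
allSubsets (suc n) = map (outside ∷_) (allSubsets n) ++ map (inside ∷_) (allSubsets n)

∈-allSubsets : ∀ (S : Subset n) → S ∈ᴸ allSubsets n
∈-allSubsets []            = here refl
∈-allSubsets (outside ∷ S) = ∈-++⁺ˡ (∈-map⁺ (outside ∷_) (∈-allSubsets S))
∈-allSubsets {suc n} (inside ∷ S) = ∈-++⁺ʳ (map (outside ∷_) (allSubsets n)) (∈-map⁺ (inside ∷_) (∈-allSubsets S))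

star : ℕ → Subset n → Family n
star {n} s Q = filter (λ S → (∣ S ∣ ≟ s) ×-dec (Q ⊆? S)) (allSubsets n)

∈-star⁺ : ∀ {s} {Q S : Subset n} → ∣ S ∣ ≡ s → Q ⊆ S → S ∈ᴸ star s Q
∈-star⁺ {s = s} {Q} {S} ∣S∣≡s Q⊆S = ∈-filter⁺ (λ S → (∣ S ∣ ≟ s) ×-dec (Q ⊆? S)) (∈-allSubsets S) (∣S∣≡s , Q⊆S)

∈-star⁻ : ∀ {s} {Q S : Subset n} → S ∈ᴸ star s Q → ∣ S ∣ ≡ s × Q ⊆ S
∈-star⁻ {n} {s} {Q} S∈ = proj₂ (∈-filter⁻ (λ S → (∣ S ∣ ≟ s) ×-dec (Q ⊆? S)) {xs = allSubsets n} S∈)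

star-uniform : ∀ {s} (Q : Subset n) → Uniform s (star s Q)
star-uniform Q S = proj₁ ∘ ∈-star⁻

star-covering : ∀ {k s} (Q : Subset n) → ∣ Q ∣ + k ≤ s → s ≤ n → Covering k (star s Q)
star-covering {k = k} {s} Q ∣Q∣+k≤s s≤n K ∣K∣≡k with superset-of-size (Q ∪ K) ∣Q∪K∣≤s s≤n
  where
  ∣Q∪K∣≤s : ∣ Q ∪ K ∣ ≤ s
  ∣Q∪K∣≤s = ≤-trans (∣p∪q∣≤∣p∣+∣q∣ Q K) (subst (λ x → ∣ Q ∣ + x ≤ s) (sym ∣K∣≡k) ∣Q∣+k≤s)
... | S , Q∪K⊆S , ∣S∣≡s = S , ∈-star⁺ ∣S∣≡s (⊆-trans (p⊆p∪q K) Q∪K⊆S) , ⊆-trans (q⊆p∪q Q K) Q∪K⊆S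

star-shattered : ∀ {s} {Q A : Subset n} → Shattered (star s Q) A → ∣ Q ∣ + ∣ A ∣ ≤ s
star-shattered {s = s} {Q} {A} shattered with shattered A ⊆-refl | shattered ⊥ ⊥⊆
... | S , S∈ , A∩S≡A | S′ , S′∈ , A∩S′≡⊥ = subst (_ ≤_) ∣S∣≡s (disjoint-⊆⇒∣p∣+∣q∣≤∣r∣ Q∩A=∅ Q⊆S A⊆S)
  where
  ∣S∣≡s : ∣ S ∣ ≡ s
  ∣S∣≡s = proj₁ (∈-star⁻ S∈)
  Q⊆S : Q ⊆ S
  Q⊆S = proj₂ (∈-star⁻ S∈)
  A⊆S : A ⊆ S
  A⊆S x∈A = p∩q⊆q A S (subst (_ ∈_) (sym A∩S≡A) x∈A)
  Q∩A=∅ : Empty (Q ∩ A)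
  Q∩A=∅ (x , x∈Q∩A) with x∈p∩q⁻ Q A x∈Q∩A
  ... | x∈Q , x∈A = ∉⊥ (subst (x ∈_) A∩S′≡⊥ (x∈p∩q⁺ (x∈A , proj₂ (∈-star⁻ S′∈) x∈Q)))

admissible-with-vc≤k : ∀ {k s n} → k ≤ s → s ≤ n →
                       ∃ λ F → Admissible k s n F × (∀ A → Shattered F A → ∣ A ∣ ≤ k)
admissible-with-vc≤k {k} {s} {n} k≤s s≤n = star s Q , (star-uniform Q , star-covering Q ∣Q∣+k≤s s≤n) , vc≤k
  where
  core : ∃ λ Q → ⊥ ⊆ Q × ∣ Q ∣ ≡ s ∸ k
  core = superset-of-size ⊥ (≤-trans (≤-reflexive (∣⊥∣≡0 n)) z≤n) (≤-trans (m∸n≤m s k) s≤n)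
  Q : Subset n
  Q = proj₁ core
  ∣Q∣+k≡s : ∣ Q ∣ + k ≡ s
  ∣Q∣+k≡s = trans (cong (_+ k) (proj₂ (proj₂ core))) (m∸n+n≡m k≤s)
  ∣Q∣+k≤s : ∣ Q ∣ + k ≤ s
  ∣Q∣+k≤s = ≤-reflexive ∣Q∣+k≡s
  vc≤k : ∀ A → Shattered (star s Q) A → ∣ A ∣ ≤ k
  vc≤k A shattered = +-cancelˡ-≤ ∣ Q ∣ _ _ (subst (∣ Q ∣ + ∣ A ∣ ≤_) (sym ∣Q∣+k≡s) (star-shattered shattered))

mainTheorem1 : (k s n : ℕ) → k ≤ s → s ≤ n → k * k * (s C k) + k ≤ n → IsD k s n k
mainTheorem1 k s n k≤s s≤n gap with admissible-with-vc≤k k≤s s≤n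
... | F , F-admissible , vc≤k with shatters-large-set k≤s gap F-admissible
...   | A , A-shattered , k≤∣A∣ =
  (F , F-admissible , (A , A-shattered , ≤-antisym (vc≤k A A-shattered) k≤∣A∣) , vc≤k) , minimal
  where
  minimal : ∀ G → Admissible k s n G → ∀ e → HasVCdim G e → k ≤ e
  minimal G G-admissible e (_ , maximal) with shatters-large-set k≤s gap G-admissible
  ... | B , B-shattered , k≤∣B∣ = ≤-trans k≤∣B∣ (maximal B B-shattered)
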